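{- Let $\sigma$ be a background on $\mathbb{Z}^d$ satisfying (i) $\sigma(x)\ge 2d-2$ for all $x\in\mathbb{Z}^d$; and (ii) there exists $r_0\in\mathbb{N}$ such that for all integers $r\ge r_0$ and all $i=1,\ldots,2d$, the outer face $F_i(Q_r)$ contains a site $x$ with $\sigma(x)\ge 2d-1$. Then $\sigma$ is explosive.
   Context: Abelian sandpile on $\mathbb{Z}^d$: a configuration is a function $\eta:\mathbb{Z}^d\to\mathbb{Z}$; a site $x$ is unstable if $\eta(x)\ge 2d$, and toppling it sends one particle to each of its $2d$ lattice neighbours. $\delta_o$ is a single particle at the origin. Given a background $\sigma$ and $n\ge1$, enumerate the sites of $\mathbb{Z}^d$ and topple, at each discrete time step, the smallest unstable site of $\sigma+n\delta_o$ (if any); $T_n$ is the set of sites that ever topple. $\sigma$ is explosive if $T_n=\mathbb{Z}^d$ for some $n$ (equivalently, for some $n$ every site topples infinitely often). $Q_r=\{x\in\mathbb{Z}^d:\max_i|x_i|\le r\}$. Let $\psi_1=e_1,\ldots,\psi_d=e_d,\psi_{d+1}=-e_1,\ldots,\psi_{2d}=-e_d$ be the coordinate directions; for a rectangular prism $R$, $F_i(R)=\{y: y\notin R,\ y-\psi_i\in R\}$ is the outer face of $R$ in direction $\psi_i$. -}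

module Defs where

open import Data.Nat as ℕ using (ℕ; zero; suc)
open import Data.Integer as ℤ using (ℤ; +_; _+_; _-_; -_; ∣_∣)
open import Data.Fin as Fin using (Fin; splitAt)
open import Data.Vec using (Vec; zipWith; tabulate; replicate; foldr)
open import Data.Vec.Relation.Unary.All using (All)
open import Data.Vec.Properties using (≡-dec)
open import Data.Sum using (_⊎_; inj₁; inj₂)
open import Data.Product using (Σ; ∃; _×_; _,_)
open import Data.Bool using (if_then_else_)
open import Relation.Nullary using (¬_; does)
open import Relation.Binary.PropositionalEquality using (_≡_)
open import Function.Bundles using (_⤖_; Bijection)

Site : ℕ → Set
Site d = Vec ℤ d

Config : ℕ → Set
Config d = Site d → ℤ

_≟ˢ_ : ∀ {d} (x y : Site d) → Relation.Nullary.Dec (x ≡ y)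
_≟ˢ_ = ≡-dec ℤ._≟_

origin : ∀ {d} → Site d
origin = replicate _ (+ 0)

_⊕_ : ∀ {d} → Site d → Site d → Site d
_⊕_ = zipWith _+_

_⊖_ : ∀ {d} → Site d → Site d → Site d
_⊖_ = zipWith _-_

dist₁ : ∀ {d} → Site d → Site d → ℕ
dist₁ x y = foldr _ ℕ._+_ 0 (zipWith (λ a b → ∣ a - b ∣) x y)

e : ∀ {d} → Fin d → Site d
e j = tabulate (λ k → if does (k Fin.≟ j) then + 1 else + 0)

-- coordinate directions ψ_1..ψ_{2d}: ψ_i = e_i for i ≤ d, ψ_{d+i} = -e_i
ψ : ∀ {d} → Fin (d ℕ.+ d) → Site d
ψ {d} i with splitAt d i
... | inj₁ j = e j
... | inj₂ j = zipWith (λ _ a → - a) (replicate d (+ 0)) (e j)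

InQ : ∀ {d} → ℕ → Site d → Set
InQ r x = All (λ a → ∣ a ∣ ℕ.≤ r) x

InFace : ∀ {d} → Fin (d ℕ.+ d) → ℕ → Site d → Set
InFace i r y = ¬ InQ r y × InQ r (y ⊖ ψ i)

thr : ℕ → ℤ
thr d = + (2 ℕ.* d)

Unstable : ∀ {d} → Config d → Site d → Set
Unstable {d} η x = thr d ℤ.≤ η x

Stable : ∀ {d} → Config d → Site d → Set
Stable {d} η x = η x ℤ.< thr d

topple : ∀ {d} → Site d → Config d → Config d
topple {d} x η y =
  (η y - (if does (y ≟ˢ x) then thr d else + 0))
  + (if does (dist₁ x y ℕ.≟ 1) then + 1 else + 0)

addAtOrigin : ∀ {d} → Config d → ℕ → Config d
addAtOrigin σ n y = σ y + (if does (y ≟ˢ origin) then + n else + 0)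

-- An enumeration of ℤ^d is a bijection with ℕ; "smaller" means smaller index.
Enumeration : ℕ → Set
Enumeration d = Site d ⤖ ℕ

index : ∀ {d} → Enumeration d → Site d → ℕ
index en = Bijection.to en

ToppleStep : ∀ {d} → Enumeration d → Config d → Site d → Config d → Set
ToppleStep en η x η' =
  Unstable η x
  × (∀ y → index en y ℕ.< index en x → Stable η y)
  × (∀ y → η' y ≡ topple x η y)

Step : ∀ {d} → Enumeration d → Config d → Config d → Set
Step en η η' =
  (∃ λ x → ToppleStep en η x η')
  ⊎ ((∀ y → Stable η y) × (∀ y → η' y ≡ η y))

record Process {d} (en : Enumeration d) (σ : Config d) (n : ℕ) : Set where
  field
    conf  : ℕ → Config d
    start : ∀ y → conf 0 y ≡ addAtOrigin σ n y
    step  : ∀ t → Step en (conf t) (conf (suc t))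

Topples : ∀ {d} {en : Enumeration d} {σ : Config d} {n : ℕ} →
          Process en σ n → Site d → Set
Topples {en = en} P x = ∃ λ t → ToppleStep en (Process.conf P t) x (Process.conf P (suc t))

Explosive : ∀ {d} → Enumeration d → Config d → Set
Explosive {d} en σ =
  ∃ λ n → 1 ℕ.≤ n × ((P : Process en σ n) → ∀ x → Topples P x)

-- The smallest-index rule is fair: an unstable site is never starved, so a site topples T times
-- as soon as its initial height plus the particles it has received reach 2d(T+1).  With
-- n = 2d·(2d)^(d r₀) particles at the origin every site of Q_r₀ topples, a site at ℓ¹-distance
-- r + 1 being fed by a neighbour at distance r.  The toppling region then grows from Q_r to Q_r+1
-- one coordinate slab at a time: the charged site (height ≥ 2d - 1) on the face topples after one
-- particle from inside, and then every other site of the slab has two toppling neighbours, which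
-- suffices because all heights are ≥ 2d - 2.
module Submission where

open import Defs
open import Data.Nat as ℕ using (ℕ; zero; suc; z≤n; s≤s)
import Data.Nat.Properties as ℕP
import Data.Nat.Tactic.RingSolver as ℕ-Solver
open import Data.Integer as ℤ using (ℤ; +_; -[1+_]; _+_; _-_; -_; _*_; ∣_∣)
import Data.Integer.Properties as ℤP
open import Data.Integer.Tactic.RingSolver using (solve-∀)
open import Data.Fin as Fin using (Fin)
import Data.Fin.Properties as FinP
open import Data.Vec as V using ([]; _∷_; lookup; updateAt)
import Data.Vec.Properties as VP
import Data.Vec.Relation.Unary.All.Properties as AllP
open import Data.List as L using (List; []; _∷_)
import Data.List.Properties as LP
open import Data.List.Membership.Propositional using (_∈_)
open import Data.List.Membership.Propositional.Properties using (∈-map⁺; ∈-map⁻)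
open import Data.List.Relation.Unary.Any using (here; there)
open import Data.Product using (∃; _×_; _,_; proj₁; proj₂)
open import Data.Sum as Sum using (_⊎_; inj₁; inj₂)
open import Data.Empty using (⊥-elim)
open import Data.Bool using (if_then_else_)
open import Relation.Nullary using (¬_; Dec; yes; no; does)
open import Relation.Nullary.Decidable using (dec-true; dec-false)
open import Relation.Binary.PropositionalEquality
open import Relation.Binary.Definitions using (DecidableEquality; tri<; tri≈; tri>)
open import Function using (_∘_)
open import Function.Bundles using (Bijection)

private variable
  d r : ℕ

𝟙 : ∀ {P : Set} → Dec P → ℕ
𝟙 (yes _) = 1
𝟙 (no _)  = 0

1≤𝟙 : ∀ {P : Set} (p : Dec P) → P → 1 ℕ.≤ 𝟙 p
1≤𝟙 (yes _) _  = ℕP.≤-refl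
1≤𝟙 (no ¬p) p = ⊥-elim (¬p p)

if-does≡𝟙 : ∀ {P : Set} (p : Dec P) m → (if does p then + m else + 0) ≡ + (m ℕ.* 𝟙 p)
if-does≡𝟙 (yes _) m = cong +_ (sym (ℕP.*-identityʳ m))
if-does≡𝟙 (no _)  m = cong +_ (sym (ℕP.*-zeroʳ m))

if-does-no : ∀ {P : Set} (p : Dec P) (i : ℤ) → ¬ P → (if does p then i else + 0) ≡ + 0
if-does-no p i ¬P = cong (λ b → if b then i else + 0) (dec-false p ¬P)

if-does-yes : ∀ {P : Set} (p : Dec P) (i : ℤ) → P → (if does p then i else + 0) ≡ i
if-does-yes p i P = cong (λ b → if b then i else + 0) (dec-true p P)

if-does-cases : ∀ {P : Set} (p : Dec P) (i : ℤ) →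
                (P × (if does p then i else + 0) ≡ i) ⊎ (if does p then i else + 0) ≡ + 0
if-does-cases (yes P) i = inj₁ (P , refl)
if-does-cases (no _)  i = inj₂ refl

≤⇒∃+ : ∀ {i j} → i ℤ.≤ j → ∃ λ m → j ≡ i + + m
≤⇒∃+ {i} {j} i≤j = ∣ j - i ∣ , (begin
  j                ≡⟨ j≡i+[j-i] i j ⟩
  i + (j - i)      ≡⟨ cong (λ z → i + z) (sym (ℤP.0≤i⇒+∣i∣≡i (ℤP.i≤j⇒0≤j-i i≤j))) ⟩
  i + + ∣ j - i ∣  ∎)
  where
  open ≡-Reasoning
  j≡i+[j-i] : ∀ i j → j ≡ i + (j - i)
  j≡i+[j-i] = solve-∀

<⇒∃+1+ : ∀ {i j} → i ℤ.< j → ∃ λ m → j ≡ i + + 1 + + m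
<⇒∃+1+ {i} i<j with ≤⇒∃+ (ℤP.i<j⇒suc[i]≤j i<j)
... | m , j≡ = m , trans j≡ (cong (_+ + m) (ℤP.+-comm (+ 1) i))

∣i∣≤n⇒-n≤i : ∀ {i n} → ∣ i ∣ ℕ.≤ n → - + n ℤ.≤ i
∣i∣≤n⇒-n≤i {+ _}      _         = ℤP.neg-≤-pos
∣i∣≤n⇒-n≤i { -[1+ _ ]} (s≤s m≤n) = ℤ.-≤- m≤n

∣i∣≤n⇒i≤n : ∀ {i n} → ∣ i ∣ ℕ.≤ n → i ℤ.≤ + n
∣i∣≤n⇒i≤n {+ _}      m≤n = ℤ.+≤+ m≤n
∣i∣≤n⇒i≤n { -[1+ _ ]} _   = ℤ.-≤+

-n≤i≤n⇒∣i∣≤n : ∀ {i n} → - + n ℤ.≤ i → i ℤ.≤ + n → ∣ i ∣ ℕ.≤ n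
-n≤i≤n⇒∣i∣≤n {+ _}      {_}     _           (ℤ.+≤+ m≤n) = m≤n
-n≤i≤n⇒∣i∣≤n { -[1+ _ ]} {suc _} (ℤ.-≤- m≤n) _           = s≤s m≤n

i+j-i≡j : ∀ i j → i + j - i ≡ j
i+j-i≡j = solve-∀

i+j-j≡i : ∀ i j → i + j - j ≡ i
i+j-j≡i = solve-∀

i≡i-j+j : ∀ i j → i ≡ i - j + j
i≡i-j+j = solve-∀

-∣i∣≤i : ∀ i → - + ∣ i ∣ ℤ.≤ i
-∣i∣≤i (+ n)    = ℤP.neg-≤-pos
-∣i∣≤i -[1+ n ] = ℤP.≤-refl

i≤∣i∣ : ∀ i → i ℤ.≤ + ∣ i ∣
i≤∣i∣ (+ n)    = ℤP.≤-refl
i≤∣i∣ -[1+ n ] = ℤ.-≤+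

∣i∣≡1+n⇒ : ∀ {i n} → ∣ i ∣ ≡ suc n → i ≡ + suc n ⊎ i ≡ -[1+ n ]
∣i∣≡1+n⇒ {+ _}      refl = inj₁ refl
∣i∣≡1+n⇒ { -[1+ _ ]} refl = inj₂ refl

∣i∣≡1+n⇒∃inward : ∀ {i n} → ∣ i ∣ ≡ suc n → ∃ λ δ → ∣ δ ∣ ≡ 1 × ∣ i + δ ∣ ≡ n
∣i∣≡1+n⇒∃inward {+ _}            refl = -[1+ 0 ] , refl , refl
∣i∣≡1+n⇒∃inward { -[1+ zero ]}  refl = + 1 , refl , refl
∣i∣≡1+n⇒∃inward { -[1+ suc _ ]} refl = + 1 , refl , refl

∣δ∣≡1⇒i≢i+δ : ∀ {i δ} → ∣ δ ∣ ≡ 1 → i ≢ i + δ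
∣δ∣≡1⇒i≢i+δ {i} {δ} ∣δ∣≡1 i≡i+δ = ℕP.0≢1+n (trans (cong ∣_∣ (sym δ≡0)) ∣δ∣≡1)
  where
  δ≡0 : δ ≡ + 0
  δ≡0 = trans (sym (i+j-i≡j i δ)) (trans (cong (_- i) (sym i≡i+δ)) (ℤP.+-inverseʳ i))

i-j≡k⇒j≡i-k : ∀ {i j k} → i - j ≡ k → j ≡ i - k
i-j≡k⇒j≡i-k {i} {j} refl = j≡i-[i-j] i j
  where
  j≡i-[i-j] : ∀ i j → j ≡ i - (i - j)
  j≡i-[i-j] = solve-∀

∣i-1∣≤n<∣i∣⇒i≡1+n : ∀ i n → ∣ i - + 1 ∣ ℕ.≤ n → n ℕ.< ∣ i ∣ → i ≡ + suc n
∣i-1∣≤n<∣i∣⇒i≡1+n (+ zero)  n _ ()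
∣i-1∣≤n<∣i∣⇒i≡1+n (+ suc m) n p q = cong (λ k → + suc k) (ℕP.≤-antisym p (ℕP.≤-pred q))
∣i-1∣≤n<∣i∣⇒i≡1+n -[1+ m ]  n p q rewrite ℕP.+-identityʳ m =
  ⊥-elim (ℕP.<-irrefl refl (ℕP.<-trans q (ℕP.≤-trans (ℕP.n<1+n (suc m)) p)))

∣i+1∣≤n<∣i∣⇒i≡-[1+n] : ∀ i n → ∣ i + + 1 ∣ ℕ.≤ n → n ℕ.< ∣ i ∣ → i ≡ -[1+ n ]
∣i+1∣≤n<∣i∣⇒i≡-[1+n] (+ m)         n p q =
  ⊥-elim (ℕP.<-irrefl refl (ℕP.<-trans q (subst (ℕ._≤ n) (cong ∣_∣ (ℤP.+-comm (+ m) (+ 1))) p)))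
∣i+1∣≤n<∣i∣⇒i≡-[1+n] -[1+ zero ]  n p q = cong -[1+_] (sym (ℕP.n≤0⇒n≡0 (ℕP.≤-pred q)))
∣i+1∣≤n<∣i∣⇒i≡-[1+n] -[1+ suc m ] n p q = cong -[1+_] (ℕP.≤-antisym p (ℕP.≤-pred q))

unitToward : ℤ → ℤ → ℤ
unitToward a b with a ℤP.<? b
... | yes _ = + 1
... | no _  = - + 1

∣unitToward∣≡1 : ∀ a b → ∣ unitToward a b ∣ ≡ 1
∣unitToward∣≡1 a b with a ℤP.<? b
... | yes _ = refl
... | no _  = refl

unitToward-closer : ∀ a b → a ≢ b → suc ∣ (a + unitToward a b) - b ∣ ≡ ∣ a - b ∣
unitToward-closer a b a≢b with a ℤP.<? b
... | yes a<b with <⇒∃+1+ a<b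
...   | m , refl = begin
  suc ∣ (a + + 1) - (a + + 1 + + m) ∣  ≡⟨ cong (λ z → suc ∣ z ∣) (up a (+ m)) ⟩
  suc ∣ - + m ∣                        ≡⟨ cong suc (ℤP.∣-i∣≡∣i∣ (+ m)) ⟩
  ∣ - + suc m ∣                        ≡⟨ cong ∣_∣ (down a (+ m)) ⟩
  ∣ a - (a + + 1 + + m) ∣              ∎
  where
  open ≡-Reasoning
  up : ∀ a m → (a + + 1) - (a + + 1 + m) ≡ - m
  up = solve-∀
  down : ∀ a m → - (+ 1 + m) ≡ a - (a + + 1 + m)
  down = solve-∀
unitToward-closer a b a≢b | no a≮b with <⇒∃+1+ (ℤP.≤∧≢⇒< (ℤP.≮⇒≥ a≮b) (a≢b ∘ sym))
... | m , refl = trans (cong (λ z → suc ∣ z ∣) (back b (+ m))) (cong ∣_∣ (ahead b (+ m)))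
  where
  back : ∀ b m → (b + + 1 + m + - + 1) - b ≡ m
  back = solve-∀
  ahead : ∀ b m → + 1 + m ≡ (b + + 1 + m) - b
  ahead = solve-∀

unitToward-stays : ∀ {a b n} → a ≢ b → ∣ a ∣ ℕ.≤ n → ∣ b ∣ ℕ.≤ n → ∣ a + unitToward a b ∣ ℕ.≤ n
unitToward-stays {a} {b} {n} a≢b ∣a∣≤n ∣b∣≤n with a ℤP.<? b
... | yes a<b = -n≤i≤n⇒∣i∣≤n
  (ℤP.≤-trans (∣i∣≤n⇒-n≤i ∣a∣≤n) (ℤP.i≤i+j a (+ 1)))
  (ℤP.≤-trans (subst (ℤ._≤ b) (ℤP.+-comm (+ 1) a) (ℤP.i<j⇒suc[i]≤j a<b)) (∣i∣≤n⇒i≤n ∣b∣≤n))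
... | no a≮b with <⇒∃+1+ (ℤP.≤∧≢⇒< (ℤP.≮⇒≥ a≮b) (a≢b ∘ sym))
...   | m , refl = -n≤i≤n⇒∣i∣≤n
  (ℤP.≤-trans (∣i∣≤n⇒-n≤i ∣b∣≤n) (ℤP.≤-trans (ℤP.i≤i+j b (+ m)) (ℤP.≤-reflexive (sym (back b (+ m))))))
  (ℤP.≤-trans (ℤP.i-j≤i (b + + 1 + + m) (+ 1)) (∣i∣≤n⇒i≤n ∣a∣≤n))
  where
  back : ∀ b m → b + + 1 + m + - + 1 ≡ b + m
  back = solve-∀

sumBelow : ℕ → (ℕ → ℤ) → ℤ
sumBelow zero    f = + 0
sumBelow (suc k) f = sumBelow k f + f k

sumBelow-+ : ∀ k f g → sumBelow k (λ i → f i + g i) ≡ sumBelow k f + sumBelow k g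
sumBelow-+ zero    f g = refl
sumBelow-+ (suc k) f g rewrite sumBelow-+ k f g = interchange (sumBelow k f) (sumBelow k g) (f k) (g k)
  where
  interchange : ∀ a b c d → a + b + (c + d) ≡ a + c + (b + d)
  interchange = solve-∀

sumBelow-neg : ∀ k f → sumBelow k (λ i → - f i) ≡ - sumBelow k f
sumBelow-neg zero    f = refl
sumBelow-neg (suc k) f rewrite sumBelow-neg k f = sym (ℤP.neg-distrib-+ (sumBelow k f) (f k))

sumBelow-*ʳ : ∀ k f c → sumBelow k (λ i → f i * c) ≡ sumBelow k f * c
sumBelow-*ʳ zero    f c = sym (ℤP.*-zeroˡ c)
sumBelow-*ʳ (suc k) f c rewrite sumBelow-*ʳ k f c = sym (ℤP.*-distribʳ-+ c (sumBelow k f) (f k))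

sumBelow-cong : ∀ k {f g} → (∀ i → i ℕ.< k → f i ≡ g i) → sumBelow k f ≡ sumBelow k g
sumBelow-cong zero    f≡g = refl
sumBelow-cong (suc k) f≡g =
  cong₂ _+_ (sumBelow-cong k (λ i i<k → f≡g i (ℕP.m≤n⇒m≤1+n i<k))) (f≡g k ℕP.≤-refl)

sumBelow-mono : ∀ k {f g} → (∀ i → i ℕ.< k → f i ℤ.≤ g i) → sumBelow k f ℤ.≤ sumBelow k g
sumBelow-mono zero    f≤g = ℤP.≤-refl
sumBelow-mono (suc k) f≤g =
  ℤP.+-mono-≤ (sumBelow-mono k (λ i i<k → f≤g i (ℕP.m≤n⇒m≤1+n i<k))) (f≤g k ℕP.≤-refl)

sumBelow-zero : ∀ k {f} → (∀ i → i ℕ.< k → f i ≡ + 0) → sumBelow k f ≡ + 0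
sumBelow-zero k f≡0 = trans (sumBelow-cong k f≡0) (sumBelow-const0 k)
  where
  sumBelow-const0 : ∀ k → sumBelow k (λ _ → + 0) ≡ + 0
  sumBelow-const0 zero    = refl
  sumBelow-const0 (suc k) = trans (ℤP.+-identityʳ _) (sumBelow-const0 k)

sumBelow-single : ∀ k j {f} → j ℕ.< k → (∀ i → i ℕ.< k → i ≢ j → f i ≡ + 0) → sumBelow k f ≡ f j
sumBelow-single (suc k) j {f} j<1+k f≡0 with k ℕP.≟ j
... | yes refl = trans
  (cong (_+ f k) (sumBelow-zero k (λ i i<k → f≡0 i (ℕP.m≤n⇒m≤1+n i<k) (λ i≡k → ℕP.<-irrefl i≡k i<k))))
  (ℤP.+-identityˡ (f k))
... | no k≢j = trans
  (cong₂ _+_ (sumBelow-single k j (ℕP.≤∧≢⇒< (ℕP.≤-pred j<1+k) (k≢j ∘ sym))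
                                  (λ i i<k → f≡0 i (ℕP.m≤n⇒m≤1+n i<k)))
             (f≡0 k ℕP.≤-refl k≢j))
  (ℤP.+-identityʳ (f j))

module _ {A : Set} where

  sumOver : List A → (A → ℤ) → ℤ
  sumOver []       f = + 0
  sumOver (a ∷ as) f = f a + sumOver as f

  sumBelow-sumOver-comm : ∀ k (L : List A) (F : ℕ → A → ℤ) →
    sumBelow k (λ i → sumOver L (F i)) ≡ sumOver L (λ u → sumBelow k (λ i → F i u))
  sumBelow-sumOver-comm k []      F = sumBelow-zero k (λ _ _ → refl)
  sumBelow-sumOver-comm k (a ∷ L) F = trans (sumBelow-+ k (λ i → F i a) (λ i → sumOver L (F i)))
    (cong (λ z → sumBelow k (λ i → F i a) + z) (sumBelow-sumOver-comm k L F))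

  sumOver-mono : ∀ (L : List A) {f g} → (∀ u → u ∈ L → f u ℤ.≤ g u) → sumOver L f ℤ.≤ sumOver L g
  sumOver-mono []      f≤g = ℤP.≤-refl
  sumOver-mono (a ∷ L) f≤g = ℤP.+-mono-≤ (f≤g a (here refl)) (sumOver-mono L (λ u u∈ → f≤g u (there u∈)))

  sumOver-nonNeg : ∀ (L : List A) {f} → (∀ u → u ∈ L → + 0 ℤ.≤ f u) → + 0 ℤ.≤ sumOver L f
  sumOver-nonNeg L f≥0 = ℤP.≤-trans (ℤP.≤-reflexive (sumOver-const0 L)) (sumOver-mono L f≥0)
    where
    sumOver-const0 : ∀ L → + 0 ≡ sumOver L (λ _ → + 0)
    sumOver-const0 []      = refl
    sumOver-const0 (_ ∷ L) = trans (sumOver-const0 L) (sym (ℤP.+-identityˡ _))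

module InjectiveSum {A : Set} (_≟_ : DecidableEquality A) (g : ℕ → A)
                    (g-injective : ∀ {i j} → g i ≡ g j → i ≡ j) where

  multiplicity : ℕ → A → ℤ
  multiplicity k u = sumBelow k (λ i → + 𝟙 (g i ≟ u))

  private
    multiplicity-cases : ∀ k u → multiplicity k u ≡ + 0
                                ⊎ (multiplicity k u ≡ + 1 × ∃ λ j → j ℕ.< k × g j ≡ u)
    multiplicity-cases zero    u = inj₁ refl
    multiplicity-cases (suc k) u with multiplicity-cases k u | g k ≟ u
    ... | inj₁ m≡0                  | yes gk≡u = inj₂ (cong (_+ + 1) m≡0 , k , ℕP.≤-refl , gk≡u)
    ... | inj₁ m≡0                  | no _     = inj₁ (cong (_+ + 0) m≡0)
    ... | inj₂ (_ , j , j<k , gj≡u) | yes gk≡u =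
      ⊥-elim (ℕP.<-irrefl (g-injective (trans gj≡u (sym gk≡u))) j<k)
    ... | inj₂ (m≡1 , j , j<k , gj≡u) | no _   = inj₂ (cong (_+ + 0) m≡1 , j , ℕP.m≤n⇒m≤1+n j<k , gj≡u)

  multiplicity≤1 : ∀ k u → multiplicity k u ℤ.≤ + 1
  multiplicity≤1 k u with multiplicity-cases k u
  ... | inj₁ m≡0       = ℤP.≤-trans (ℤP.≤-reflexive m≡0) (ℤ.+≤+ z≤n)
  ... | inj₂ (m≡1 , _) = ℤP.≤-reflexive m≡1

  𝟙*-nonNeg : ∀ y u {w} → + 0 ℤ.≤ w → + 0 ℤ.≤ + 𝟙 (y ≟ u) * w
  𝟙*-nonNeg y u {w} w≥0 with y ≟ u
  ... | yes _ = subst (+ 0 ℤ.≤_) (sym (ℤP.*-identityˡ w)) w≥0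
  ... | no _  = ℤP.≤-refl

  ≤sumOver-𝟙* : ∀ (L : List A) y (w : A → ℤ) → y ∈ L → (∀ u → u ∈ L → + 0 ℤ.≤ w u) →
                w y ℤ.≤ sumOver L (λ u → + 𝟙 (y ≟ u) * w u)
  ≤sumOver-𝟙* (a ∷ L) y w (here refl) w≥0 with y ≟ y
  ... | no y≢y = ⊥-elim (y≢y refl)
  ... | yes _  = subst (ℤ._≤ + 1 * w y + sumOver L (λ u → + 𝟙 (y ≟ u) * w u)) (ℤP.+-identityʳ (w y))
    (ℤP.+-mono-≤ (ℤP.≤-reflexive (sym (ℤP.*-identityˡ (w y))))
                 (sumOver-nonNeg L (λ u u∈ → 𝟙*-nonNeg y u (w≥0 u (there u∈)))))
  ≤sumOver-𝟙* (a ∷ L) y w (there y∈) w≥0 =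
    subst (ℤ._≤ + 𝟙 (y ≟ a) * w a + sumOver L (λ u → + 𝟙 (y ≟ u) * w u)) (ℤP.+-identityˡ (w y))
      (ℤP.+-mono-≤ (𝟙*-nonNeg y a (w≥0 a (here refl)))
                   (≤sumOver-𝟙* L y w y∈ (λ u u∈ → w≥0 u (there u∈))))

  sumBelow≤sumOver : ∀ k (L : List A) (w : A → ℤ) (f : ℕ → ℤ) → (∀ u → u ∈ L → + 0 ℤ.≤ w u) →
    (∀ i → i ℕ.< k → f i ℤ.≤ sumOver L (λ u → + 𝟙 (g i ≟ u) * w u)) → sumBelow k f ℤ.≤ sumOver L w
  sumBelow≤sumOver k L w f w≥0 f≤ = begin
    sumBelow k f                                          ≤⟨ sumBelow-mono k f≤ ⟩
    sumBelow k (λ i → sumOver L (λ u → + 𝟙 (g i ≟ u) * w u))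
      ≡⟨ sumBelow-sumOver-comm k L (λ i u → + 𝟙 (g i ≟ u) * w u) ⟩
    sumOver L (λ u → sumBelow k (λ i → + 𝟙 (g i ≟ u) * w u))
      ≤⟨ sumOver-mono L (λ u u∈ → ℤP.≤-trans (ℤP.≤-reflexive (sumBelow-*ʳ k _ (w u)))
           (ℤP.≤-trans (ℤP.*-monoʳ-≤-nonNeg (w u) {{ℤ.nonNegative (w≥0 u u∈)}} (multiplicity≤1 k u))
                       (ℤP.≤-reflexive (ℤP.*-identityˡ (w u))))) ⟩
    sumOver L w                                           ∎
    where open ℤP.≤-Reasoning

partialSum : (ℕ → ℕ) → ℕ → ℕ
partialSum f zero    = 0
partialSum f (suc t) = partialSum f t ℕ.+ f t

partialSum-mono : ∀ f {t t'} → t ℕ.≤ t' → partialSum f t ℕ.≤ partialSum f t'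
partialSum-mono f {t} t≤t' =
  subst (λ u → partialSum f t ℕ.≤ partialSum f u) (ℕP.m+[n∸m]≡n t≤t') (≤partialSum-+ t _)
  where
  ≤partialSum-+ : ∀ t j → partialSum f t ℕ.≤ partialSum f (t ℕ.+ j)
  ≤partialSum-+ t zero    = ℕP.≤-reflexive (cong (partialSum f) (sym (ℕP.+-identityʳ t)))
  ≤partialSum-+ t (suc j) rewrite ℕP.+-suc t j = ℕP.≤-trans (≤partialSum-+ t j) (ℕP.m≤m+n _ _)

partialSum-≤ : ∀ {f g} → (∀ t → f t ℕ.≤ g t) → ∀ t → partialSum f t ℕ.≤ partialSum g t
partialSum-≤ f≤g zero    = z≤n
partialSum-≤ f≤g (suc t) = ℕP.+-mono-≤ (partialSum-≤ f≤g t) (f≤g t)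

partialSum-+ : ∀ f g t → partialSum (λ s → f s ℕ.+ g s) t ≡ partialSum f t ℕ.+ partialSum g t
partialSum-+ f g zero    = refl
partialSum-+ f g (suc t) rewrite partialSum-+ f g t = interchange (partialSum f t) (partialSum g t) (f t) (g t)
  where
  interchange : ∀ a b c d → a ℕ.+ b ℕ.+ (c ℕ.+ d) ≡ a ℕ.+ c ℕ.+ (b ℕ.+ d)
  interchange = ℕ-Solver.solve-∀

≤partialSum : ∀ f {i t} → i ℕ.< t → f i ℕ.≤ partialSum f t
≤partialSum f {i} {suc t} i<1+t with i ℕP.≟ t
... | yes refl = ℕP.m≤n+m _ _
... | no i≢t   = ℕP.≤-trans (≤partialSum f (ℕP.≤∧≢⇒< (ℕP.≤-pred i<1+t) i≢t)) (ℕP.m≤m+n _ _)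

partialSum-pos : ∀ f t → 1 ℕ.≤ partialSum f t → ∃ λ s → 1 ℕ.≤ f s
partialSum-pos f (suc t) p with f t in ft≡
... | zero  = partialSum-pos f t (subst (1 ℕ.≤_) (ℕP.+-identityʳ _) p)
... | suc _ = t , subst (1 ℕ.≤_) (sym ft≡) (s≤s z≤n)

shift : Fin d → ℤ → Site d → Site d
shift k δ y = updateAt y k (_+ δ)

dist₁-refl : (x : Site d) → dist₁ x x ≡ 0
dist₁-refl []       = refl
dist₁-refl (a ∷ xs) rewrite ℤP.+-inverseʳ a = dist₁-refl xs

dist₁≡0⇒≡ : (x y : Site d) → dist₁ x y ≡ 0 → x ≡ y
dist₁≡0⇒≡ []      []      _ = refl
dist₁≡0⇒≡ (a ∷ x) (b ∷ y) p = cong₂ _∷_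
  (ℤP.i-j≡0⇒i≡j a b (ℤP.∣i∣≡0⇒i≡0 (ℕP.m+n≡0⇒m≡0 _ p)))
  (dist₁≡0⇒≡ x y (ℕP.m+n≡0⇒n≡0 _ p))

dist₁-shift : ∀ k δ (x : Site d) → dist₁ (shift k δ x) x ≡ ∣ δ ∣
dist₁-shift Fin.zero    δ (a ∷ xs) rewrite dist₁-refl xs =
  trans (ℕP.+-identityʳ _) (cong ∣_∣ (i+j-i≡j a δ))
dist₁-shift (Fin.suc k) δ (a ∷ xs) rewrite ℤP.+-inverseʳ a = dist₁-shift k δ xs

≢⇒∃lookup≢ : (x y : Site d) → x ≢ y → ∃ λ k → lookup x k ≢ lookup y k
≢⇒∃lookup≢ []      []      x≢y = ⊥-elim (x≢y refl)
≢⇒∃lookup≢ (a ∷ x) (b ∷ y) x≢y with a ℤ.≟ b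
... | no a≢b   = Fin.zero , a≢b
... | yes refl with ≢⇒∃lookup≢ x y (x≢y ∘ cong (a ∷_))
...   | k , p  = Fin.suc k , p

stepToward : Fin d → Site d → Site d → Site d
stepToward k x s = shift k (unitToward (lookup x k) (lookup s k)) x

dist₁-stepToward : ∀ k (x s : Site d) → lookup x k ≢ lookup s k →
                   suc (dist₁ (stepToward k x s) s) ≡ dist₁ x s
dist₁-stepToward Fin.zero    (a ∷ x) (b ∷ s) a≢b = cong (ℕ._+ dist₁ x s) (unitToward-closer a b a≢b)
dist₁-stepToward (Fin.suc k) (a ∷ x) (b ∷ s) ne =
  trans (sym (ℕP.+-suc ∣ a - b ∣ _)) (cong (∣ a - b ∣ ℕ.+_) (dist₁-stepToward k x s ne))

dist₁-stepToward-from : ∀ k (x s : Site d) → dist₁ (stepToward k x s) x ≡ 1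
dist₁-stepToward-from k x s = trans (dist₁-shift k _ x) (∣unitToward∣≡1 (lookup x k) (lookup s k))

∣lookup∣≤dist₁-origin : (x : Site d) (k : Fin d) → ∣ lookup x k ∣ ℕ.≤ dist₁ x origin
∣lookup∣≤dist₁-origin (a ∷ x) Fin.zero    rewrite ℤP.+-identityʳ a = ℕP.m≤m+n _ _
∣lookup∣≤dist₁-origin (a ∷ x) (Fin.suc k) = ℕP.≤-trans (∣lookup∣≤dist₁-origin x k) (ℕP.m≤n+m _ _)

InBox : (Fin d → ℕ) → Site d → Set
InBox b y = ∀ k → ∣ lookup y k ∣ ℕ.≤ b k

InBox-shift : ∀ {b : Fin d → ℕ} {y} k δ → InBox b y → ∣ lookup y k + δ ∣ ℕ.≤ b k →
              InBox b (shift k δ y)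
InBox-shift {b = b} {y} k δ y∈B ∣yₖ+δ∣≤bₖ j with j FinP.≟ k
... | yes refl = subst (λ z → ∣ z ∣ ℕ.≤ b k) (sym (VP.lookup∘updateAt k y)) ∣yₖ+δ∣≤bₖ
... | no j≢k   = subst (λ z → ∣ z ∣ ℕ.≤ b j) (sym (VP.lookup∘updateAt′ j k j≢k y)) (y∈B j)

InBox-by-axis : ∀ {b : Fin d → ℕ} {y} m → ∣ lookup y m ∣ ℕ.≤ b m →
                (∀ k → k ≢ m → ∣ lookup y k ∣ ℕ.≤ b k) → InBox b y
InBox-by-axis m on-axis off-axis k with k FinP.≟ m
... | yes refl = on-axis
... | no k≢m   = off-axis k k≢m

InBox-const⇒dist₁-origin≤ : (y : Site d) → InBox (λ _ → r) y → dist₁ y origin ℕ.≤ d ℕ.* r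
InBox-const⇒dist₁-origin≤ []      _   = z≤n
InBox-const⇒dist₁-origin≤ (a ∷ y) y∈B rewrite ℤP.+-identityʳ a =
  ℕP.+-mono-≤ (y∈B Fin.zero) (InBox-const⇒dist₁-origin≤ y (y∈B ∘ Fin.suc))

growingBox : ℕ → ℕ → Fin d → ℕ
growingBox r j k with Fin.toℕ k ℕP.<? j
... | yes _ = suc r
... | no _  = r

growingBox-zero : ∀ r (k : Fin d) → growingBox r 0 k ≡ r
growingBox-zero r k with Fin.toℕ k ℕP.<? 0
... | no _ = refl

growingBox-full : ∀ r (k : Fin d) → growingBox r d k ≡ suc r
growingBox-full {d} r k with Fin.toℕ k ℕP.<? d
... | yes _   = refl
... | no k≮d = ⊥-elim (k≮d (FinP.toℕ<n k))

r≤growingBox : ∀ r j (k : Fin d) → r ℕ.≤ growingBox r j k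
r≤growingBox r j k with Fin.toℕ k ℕP.<? j
... | yes _ = ℕP.n≤1+n r
... | no _  = ℕP.≤-refl

growingBox-at : ∀ r {j} (m : Fin d) → Fin.toℕ m ≡ j → growingBox r j m ≡ r
growingBox-at r m refl with Fin.toℕ m ℕP.<? Fin.toℕ m
... | yes m<m = ⊥-elim (ℕP.<-irrefl refl m<m)
... | no _    = refl

growingBox-suc-at : ∀ r {j} (m : Fin d) → Fin.toℕ m ≡ j → growingBox r (suc j) m ≡ suc r
growingBox-suc-at r m refl with Fin.toℕ m ℕP.<? suc (Fin.toℕ m)
... | yes _  = refl
... | no m≮ = ⊥-elim (m≮ ℕP.≤-refl)

growingBox-suc-off : ∀ r {j} {m k : Fin d} → Fin.toℕ m ≡ j → k ≢ m → growingBox r (suc j) k ≡ growingBox r j k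
growingBox-suc-off r {j} {m} {k} refl k≢m with Fin.toℕ k ℕP.<? suc j | Fin.toℕ k ℕP.<? j
... | yes _ | yes _ = refl
... | no _  | no _  = refl
... | no k≮1+j | yes k<j = ⊥-elim (k≮1+j (ℕP.m≤n⇒m≤1+n k<j))
... | yes k<1+j | no k≮j = ⊥-elim (k≢m (FinP.toℕ-injective (ℕP.≤-antisym (ℕP.≤-pred k<1+j) (ℕP.≮⇒≥ k≮j))))

lookup-⊖ : (x v : Site d) (k : Fin d) → lookup (x ⊖ v) k ≡ lookup x k - lookup v k
lookup-⊖ x v k = VP.lookup-zipWith _ k x v

lookup-e-on-axis : (m : Fin d) → lookup (e m) m ≡ + 1
lookup-e-on-axis m = trans (VP.lookup∘tabulate _ m) (if-does-yes (m FinP.≟ m) (+ 1) refl)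

lookup-e-off-axis : {m k : Fin d} → k ≢ m → lookup (e m) k ≡ + 0
lookup-e-off-axis {m = m} {k} k≢m = trans (VP.lookup∘tabulate _ k) (if-does-no (k FinP.≟ m) (+ 1) k≢m)

ψ-↑ˡ : (m : Fin d) → ψ (m Fin.↑ˡ d) ≡ e m
ψ-↑ˡ {d} m rewrite FinP.splitAt-↑ˡ d m d = refl

lookup-ψ-↑ʳ : (m k : Fin d) → lookup (ψ (d Fin.↑ʳ m)) k ≡ - lookup (e m) k
lookup-ψ-↑ʳ {d} m k rewrite FinP.splitAt-↑ʳ d d m = VP.lookup-zipWith _ k (V.replicate d (+ 0)) (e m)

module _ {x v : Site d} (m : Fin d) (v-on-axis : ∀ k → k ≢ m → lookup v k ≡ + 0)
         (x∉Q : ¬ InQ r x) (x-v∈Q : InQ r (x ⊖ v)) where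

  face-off-axis : ∀ k → k ≢ m → ∣ lookup x k ∣ ℕ.≤ r
  face-off-axis k k≢m = subst (λ z → ∣ z ∣ ℕ.≤ r)
    (trans (lookup-⊖ x v k) (trans (cong (λ z → lookup x k - z) (v-on-axis k k≢m)) (ℤP.+-identityʳ (lookup x k))))
    (AllP.lookup⁺ x-v∈Q k)

  face-on-axis : ∣ lookup x m - lookup v m ∣ ℕ.≤ r
  face-on-axis = subst (λ z → ∣ z ∣ ℕ.≤ r) (lookup-⊖ x v m) (AllP.lookup⁺ x-v∈Q m)

  face-outside : r ℕ.< ∣ lookup x m ∣
  face-outside with ∣ lookup x m ∣ ℕP.≤? r
  ... | no ∣xₘ∣≰r = ℕP.≰⇒> ∣xₘ∣≰r
  ... | yes ∣xₘ∣≤r = ⊥-elim (x∉Q (AllP.lookup⁻ (InBox-by-axis {y = x} m ∣xₘ∣≤r face-off-axis)))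

face-↑ˡ : ∀ {m : Fin d} {x} → InFace (m Fin.↑ˡ d) r x →
          (∀ k → k ≢ m → ∣ lookup x k ∣ ℕ.≤ r) × lookup x m ≡ + suc r
face-↑ˡ {d} {r} {m} {x} (x∉Q , x-v∈Q) =
  face-off-axis m v-on-axis x∉Q x-v∈Q ,
  ∣i-1∣≤n<∣i∣⇒i≡1+n (lookup x m) r
    (subst (λ z → ∣ lookup x m - z ∣ ℕ.≤ r) (trans (cong (λ v → lookup v m) (ψ-↑ˡ m)) (lookup-e-on-axis m))
      (face-on-axis m v-on-axis x∉Q x-v∈Q))
    (face-outside m v-on-axis x∉Q x-v∈Q)
  where
  v-on-axis : ∀ k → k ≢ m → lookup (ψ (m Fin.↑ˡ d)) k ≡ + 0
  v-on-axis k k≢m = trans (cong (λ v → lookup v k) (ψ-↑ˡ m)) (lookup-e-off-axis k≢m)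

face-↑ʳ : ∀ {m : Fin d} {x} → InFace (d Fin.↑ʳ m) r x →
          (∀ k → k ≢ m → ∣ lookup x k ∣ ℕ.≤ r) × lookup x m ≡ -[1+ r ]
face-↑ʳ {d} {r} {m} {x} (x∉Q , x-v∈Q) =
  face-off-axis m v-on-axis x∉Q x-v∈Q ,
  ∣i+1∣≤n<∣i∣⇒i≡-[1+n] (lookup x m) r
    (subst (λ z → ∣ lookup x m - z ∣ ℕ.≤ r) (trans (lookup-ψ-↑ʳ m m) (cong -_ (lookup-e-on-axis m)))
      (face-on-axis m v-on-axis x∉Q x-v∈Q))
    (face-outside m v-on-axis x∉Q x-v∈Q)
  where
  v-on-axis : ∀ k → k ≢ m → lookup (ψ (d Fin.↑ʳ m)) k ≡ + 0
  v-on-axis k k≢m = trans (lookup-ψ-↑ʳ m k) (cong -_ (lookup-e-off-axis k≢m))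

neighbours : Site d → List (Site d)
neighbours []      = []
neighbours (a ∷ y) = (a + + 1 ∷ y) ∷ (a - + 1 ∷ y) ∷ L.map (a ∷_) (neighbours y)

length-neighbours : (y : Site d) → L.length (neighbours y) ≡ 2 ℕ.* d
length-neighbours []              = refl
length-neighbours {suc d} (a ∷ y) = trans
  (cong (λ n → suc (suc n)) (trans (LP.length-map (a ∷_) (neighbours y)) (length-neighbours y)))
  (sym (ℕP.*-suc 2 d))

dist₁≡1⇒∈neighbours : (z y : Site d) → dist₁ z y ≡ 1 → y ∈ neighbours z
dist₁≡1⇒∈neighbours []       []       ()
dist₁≡1⇒∈neighbours (a ∷ zs) (b ∷ ys) h with ∣ a - b ∣ in ∣a-b∣≡
... | zero rewrite ℤP.i-j≡0⇒i≡j a b (ℤP.∣i∣≡0⇒i≡0 ∣a-b∣≡) =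
  there (there (∈-map⁺ (b ∷_) (dist₁≡1⇒∈neighbours zs ys h)))
... | suc zero rewrite dist₁≡0⇒≡ zs ys (ℕP.suc-injective h) with ∣i∣≡1+n⇒ {a - b} ∣a-b∣≡
...   | inj₁ a-b≡1  = there (here (cong (_∷ ys) (i-j≡k⇒j≡i-k {a} {b} a-b≡1)))
...   | inj₂ a-b≡-1 = here (cong (_∷ ys) (i-j≡k⇒j≡i-k {a} {b} a-b≡-1))
dist₁≡1⇒∈neighbours (a ∷ zs) (b ∷ ys) () | suc (suc _)

∈neighbours⇒∣head∣≤ : (z u : Site (suc d)) → u ∈ neighbours z → ∣ V.head u ∣ ℕ.≤ suc ∣ V.head z ∣
∈neighbours⇒∣head∣≤ (a ∷ _) _ (here refl) =
  ℕP.≤-trans (ℤP.∣i+j∣≤∣i∣+∣j∣ a (+ 1)) (ℕP.≤-reflexive (ℕP.+-comm ∣ a ∣ 1))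
∈neighbours⇒∣head∣≤ (a ∷ _) _ (there (here refl)) =
  ℕP.≤-trans (ℤP.∣i-j∣≤∣i∣+∣j∣ a (+ 1)) (ℕP.≤-reflexive (ℕP.+-comm ∣ a ∣ 1))
∈neighbours⇒∣head∣≤ (a ∷ ys) u (there (there u∈)) with ∈-map⁻ (a ∷_) u∈
... | _ , _ , refl = ℕP.n≤1+n ∣ a ∣

parabola : ℤ → Site (suc d) → ℤ
parabola A y = A - V.head y * V.head y

parabola-nonNeg : ∀ {A} (y : Site (suc d)) M → ∣ V.head y ∣ ℕ.≤ M → + (M ℕ.* M) ℤ.≤ A →
                  + 0 ℤ.≤ parabola A y
parabola-nonNeg y M ∣y₁∣≤M M²≤A = ℤP.i≤j⇒0≤j-i (ℤP.≤-trans (ℤP.≤-reflexive (i*i≡∣i∣*∣i∣ (V.head y)))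
  (ℤP.≤-trans (ℤ.+≤+ (ℕP.*-mono-≤ ∣y₁∣≤M ∣y₁∣≤M)) M²≤A))
  where
  i*i≡∣i∣*∣i∣ : ∀ i → i * i ≡ + (∣ i ∣ ℕ.* ∣ i ∣)
  i*i≡∣i∣*∣i∣ (+ n)    = sym (ℤP.pos-* n n)
  i*i≡∣i∣*∣i∣ -[1+ n ] = refl

sumOver-neighbours-parabola : ∀ A (z : Site (suc d)) →
  sumOver (neighbours z) (parabola A) ≡ + (2 ℕ.* suc d) * parabola A z - + 2
sumOver-neighbours-parabola {d} A (a ∷ ys) = begin
  up + (down + sumOver (L.map (a ∷_) (neighbours ys)) (parabola A))
    ≡⟨ cong (λ s → up + (down + s))
         (trans (sumOver-map (neighbours ys)) (cong (λ n → + n * (A - a * a)) (length-neighbours ys))) ⟩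
  up + (down + + (2 ℕ.* d) * (A - a * a))
    ≡⟨ laplacian A a (+ (2 ℕ.* d)) ⟩
  (+ 2 + + (2 ℕ.* d)) * (A - a * a) - + 2
    ≡⟨ cong (λ n → n * (A - a * a) - + 2) (trans (sym (ℤP.pos-+ 2 (2 ℕ.* d))) (cong +_ (sym (ℕP.*-suc 2 d)))) ⟩
  + (2 ℕ.* suc d) * (A - a * a) - + 2 ∎
  where
  open ≡-Reasoning
  up   = A - (a + + 1) * (a + + 1)
  down = A - (a - + 1) * (a - + 1)
  sumOver-map : ∀ (L : List (Site d)) → sumOver (L.map (a ∷_) L) (parabola A) ≡ + L.length L * (A - a * a)
  sumOver-map []      = refl
  sumOver-map (y ∷ L) rewrite sumOver-map L = w+nw≡[1+n]w (A - a * a) (+ L.length L)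
    where
    w+nw≡[1+n]w : ∀ w n → w + n * w ≡ (+ 1 + n) * w
    w+nw≡[1+n]w = solve-∀
  laplacian : ∀ A a n → (A - (a + + 1) * (a + + 1)) + ((A - (a - + 1) * (a - + 1)) + n * (A - a * a))
                      ≡ (+ 2 + n) * (A - a * a) - + 2
  laplacian = solve-∀

-- The toppling process

topple-≥ : (x : Site d) (η : Config d) (y : Site d) →
           η y - (if does (y ≟ˢ x) then thr d else + 0) ℤ.≤ topple x η y
topple-≥ {d} x η y = ℤP.≤-trans (ℤP.≤-reflexive (sym (ℤP.+-identityʳ _)))
  (ℤP.+-monoʳ-≤ (η y - (if does (y ≟ˢ x) then thr d else + 0)) (0≤if (dist₁ x y ℕ.≟ 1)))
  where
  0≤if : ∀ {P : Set} (p : Dec P) → + 0 ℤ.≤ (if does p then + 1 else + 0)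
  0≤if (yes _) = ℤ.+≤+ z≤n
  0≤if (no _)  = ℤP.≤-refl

Stable⇒¬Unstable : (η : Config d) (x : Site d) → Stable η x → ¬ Unstable η x
Stable⇒¬Unstable η x = ℤP.<⇒≱

ToppleStep-unique : ∀ {en : Enumeration d} {η η' η'' x x'} →
                    ToppleStep en η x η' → ToppleStep en η x' η'' → x ≡ x'
ToppleStep-unique {en = en} {η} {x = x} {x'} (x-unstable , below-x , _) (x'-unstable , below-x' , _)
  with ℕP.<-cmp (index en x) (index en x')
... | tri< x<x' _ _ = ⊥-elim (Stable⇒¬Unstable η x (below-x' x x<x') x-unstable)
... | tri≈ _ x≡x' _ = Bijection.injective en x≡x'
... | tri> _ _ x>x' = ⊥-elim (Stable⇒¬Unstable η x' (below-x x' x>x') x'-unstable)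

module Bookkeeping {en : Enumeration d} {σ : Config d} {n : ℕ} (P : Process en σ n) where
  open Process P

  K : ℕ
  K = 2 ℕ.* d

  ToppleAt : ℕ → Site d → Set
  ToppleAt t x = ToppleStep en (conf t) x (conf (suc t))

  toppledAt : ℕ → Site d → ℕ
  toppledAt t y with step t
  ... | inj₁ (x , _) = 𝟙 (y ≟ˢ x)
  ... | inj₂ _       = 0

  receivedAt : ℕ → Site d → ℕ
  receivedAt t y with step t
  ... | inj₁ (x , _) = 𝟙 (dist₁ x y ℕ.≟ 1)
  ... | inj₂ _       = 0

  toppled : ℕ → Site d → ℕ
  toppled t y = partialSum (λ s → toppledAt s y) t

  received : ℕ → Site d → ℕ
  received t y = partialSum (λ s → receivedAt s y) t

  step-balance : ∀ t y → conf (suc t) y + + (K ℕ.* toppledAt t y) ≡ conf t y + + receivedAt t y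
  step-balance t y with step t
  ... | inj₂ (_ , unchanged) = cong₂ _+_ (unchanged y) (cong +_ (ℕP.*-zeroʳ K))
  ... | inj₁ (x , _ , _ , toppling) = begin
    conf (suc t) y + + (K ℕ.* 𝟙 (y ≟ˢ x))
      ≡⟨ cong (_+ + (K ℕ.* 𝟙 (y ≟ˢ x))) (toppling y) ⟩
    (conf t y - (if does (y ≟ˢ x) then + K else + 0)) + (if does (dist₁ x y ℕ.≟ 1) then + 1 else + 0)
      + + (K ℕ.* 𝟙 (y ≟ˢ x))
      ≡⟨ cong₂ (λ a b → (conf t y - a) + b + + (K ℕ.* 𝟙 (y ≟ˢ x)))
           (if-does≡𝟙 (y ≟ˢ x) K) (trans (if-does≡𝟙 (dist₁ x y ℕ.≟ 1) 1) (cong +_ (ℕP.*-identityˡ _))) ⟩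
    (conf t y - + (K ℕ.* 𝟙 (y ≟ˢ x))) + + 𝟙 (dist₁ x y ℕ.≟ 1) + + (K ℕ.* 𝟙 (y ≟ˢ x))
      ≡⟨ cancel (conf t y) _ _ ⟩
    conf t y + + 𝟙 (dist₁ x y ℕ.≟ 1) ∎
    where
    open ≡-Reasoning
    cancel : ∀ c a b → (c - a) + b + a ≡ c + b
    cancel = solve-∀

  conservation : ∀ t y → conf t y + + (K ℕ.* toppled t y) ≡ conf 0 y + + received t y
  conservation zero    y = cong (λ m → conf 0 y + + m) (ℕP.*-zeroʳ K)
  conservation (suc t) y = begin
    conf (suc t) y + + (K ℕ.* (toppled t y ℕ.+ toppledAt t y))
      ≡⟨ cong (λ m → conf (suc t) y + + m) (ℕP.*-distribˡ-+ K (toppled t y) _) ⟩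
    conf (suc t) y + + (K ℕ.* toppled t y ℕ.+ K ℕ.* toppledAt t y)
      ≡⟨ cong (λ z → conf (suc t) y + z) (ℤP.pos-+ (K ℕ.* toppled t y) _) ⟩
    conf (suc t) y + (+ (K ℕ.* toppled t y) + + (K ℕ.* toppledAt t y))
      ≡⟨ swap₁ (conf (suc t) y) _ _ ⟩
    conf (suc t) y + + (K ℕ.* toppledAt t y) + + (K ℕ.* toppled t y)
      ≡⟨ cong (_+ + (K ℕ.* toppled t y)) (step-balance t y) ⟩
    conf t y + + receivedAt t y + + (K ℕ.* toppled t y)
      ≡⟨ swap₂ (conf t y) _ _ ⟩
    conf t y + + (K ℕ.* toppled t y) + + receivedAt t y
      ≡⟨ cong (_+ + receivedAt t y) (conservation t y) ⟩
    conf 0 y + + received t y + + receivedAt t y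
      ≡⟨ trans (ℤP.+-assoc (conf 0 y) _ _) (cong (λ z → conf 0 y + z) (sym (ℤP.pos-+ (received t y) _))) ⟩
    conf 0 y + + received (suc t) y ∎
    where
    open ≡-Reasoning
    swap₁ : ∀ a b c → a + (b + c) ≡ a + c + b
    swap₁ = solve-∀
    swap₂ : ∀ a b c → a + b + c ≡ a + c + b
    swap₂ = solve-∀

  ToppleAt⇒toppledAt≡1 : ∀ {t x} → ToppleAt t x → toppledAt t x ≡ 1
  ToppleAt⇒toppledAt≡1 {t} {x} x-topples with step t
  ... | inj₂ (all-stable , _) = ⊥-elim (Stable⇒¬Unstable (conf t) x (all-stable x) (proj₁ x-topples))
  ... | inj₁ (x' , x'-topples) with x ≟ˢ x'
  ...   | yes _    = refl
  ...   | no x≢x' = ⊥-elim (x≢x' (ToppleStep-unique {en = en} {η' = conf (suc t)} {η'' = conf (suc t)}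
                                                     x-topples x'-topples))

  toppled-pos⇒ToppleAt : ∀ t x → 1 ℕ.≤ toppled t x → ∃ λ s → ToppleAt s x
  toppled-pos⇒ToppleAt t x p with partialSum-pos (λ s → toppledAt s x) t p
  ... | s , q = s , toppledAt-pos⇒ToppleAt s q
    where
    toppledAt-pos⇒ToppleAt : ∀ s → 1 ℕ.≤ toppledAt s x → ToppleAt s x
    toppledAt-pos⇒ToppleAt s q with step s
    ... | inj₁ (x' , x'-topples) with x ≟ˢ x'
    ...   | yes refl = x'-topples
    toppledAt-pos⇒ToppleAt s () | inj₁ _ | no _
    toppledAt-pos⇒ToppleAt s () | inj₂ _

  toppledAt≤receivedAt : ∀ {z y} → dist₁ z y ≡ 1 → ∀ t → toppledAt t z ℕ.≤ receivedAt t y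
  toppledAt≤receivedAt {z} {y} z~y t with step t
  ... | inj₂ _ = z≤n
  ... | inj₁ (x , _) with z ≟ˢ x
  ...   | no _     = z≤n
  ...   | yes refl = 1≤𝟙 (dist₁ z y ℕ.≟ 1) z~y

  toppledAt₂≤receivedAt : ∀ {z₁ z₂ y} → z₁ ≢ z₂ → dist₁ z₁ y ≡ 1 → dist₁ z₂ y ≡ 1 →
                          ∀ t → toppledAt t z₁ ℕ.+ toppledAt t z₂ ℕ.≤ receivedAt t y
  toppledAt₂≤receivedAt {z₁} {z₂} {y} z₁≢z₂ z₁~y z₂~y t with step t
  ... | inj₂ _ = z≤n
  ... | inj₁ (x , _) with z₁ ≟ˢ x | z₂ ≟ˢ x
  ...   | yes refl | yes refl = ⊥-elim (z₁≢z₂ refl)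
  ...   | yes refl | no _     = 1≤𝟙 (dist₁ z₁ y ℕ.≟ 1) z₁~y
  ...   | no _     | yes refl = 1≤𝟙 (dist₁ z₂ y ℕ.≟ 1) z₂~y
  ...   | no _ | no _ = z≤n

  received≥toppled : ∀ {z y} → dist₁ z y ≡ 1 → ∀ t → toppled t z ℕ.≤ received t y
  received≥toppled z~y = partialSum-≤ (toppledAt≤receivedAt z~y)

  received≥toppled₂ : ∀ {z₁ z₂ y} → z₁ ≢ z₂ → dist₁ z₁ y ≡ 1 → dist₁ z₂ y ≡ 1 →
                      ∀ t → toppled t z₁ ℕ.+ toppled t z₂ ℕ.≤ received t y
  received≥toppled₂ z₁≢z₂ z₁~y z₂~y t = subst (ℕ._≤ received t _) (partialSum-+ _ _ t)
    (partialSum-≤ (toppledAt₂≤receivedAt z₁≢z₂ z₁~y z₂~y) t)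

  unstable-while-undertoppled : ∀ T t y → toppled t y ℕ.≤ T →
    + (K ℕ.* suc T) ℤ.≤ conf 0 y + + received t y → Unstable (conf t) y
  unstable-while-undertoppled T t y toppled≤T K[1+T]≤ = begin
    + K                                              ≡⟨ sym K[1+T]-KT≡K ⟩
    + (K ℕ.* suc T) - + (K ℕ.* T)
      ≤⟨ ℤP.+-mono-≤ K[1+T]≤ (ℤP.neg-mono-≤ (ℤ.+≤+ (ℕP.*-monoʳ-≤ K toppled≤T))) ⟩
    conf 0 y + + received t y - + (K ℕ.* toppled t y) ≡⟨ cong (_- + (K ℕ.* toppled t y)) (sym (conservation t y)) ⟩
    conf t y + + (K ℕ.* toppled t y) - + (K ℕ.* toppled t y) ≡⟨ i+j-j≡i (conf t y) _ ⟩
    conf t y                                         ∎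
    where
    open ℤP.≤-Reasoning
    K[1+T]-KT≡K : + (K ℕ.* suc T) - + (K ℕ.* T) ≡ + K
    K[1+T]-KT≡K = trans (cong (λ m → + m - + (K ℕ.* T)) (ℕP.*-suc K T))
                        (trans (cong (_- + (K ℕ.* T)) (ℤP.pos-+ K _)) (i+j-j≡i (+ K) (+ (K ℕ.* T))))

-- While an unstable site x waits, only the finitely many sites of smaller index topple, and each
-- such toppling lowers the potential Φ = Σ w·η over these sites by at least 2, the weight
-- w = A - y₁² being concave on the lattice; but Φ is bounded below, since a site that topples is
-- left with a nonnegative height and every other height only grows.
module Fairness {en : Enumeration (suc d)} {σ : Config (suc d)} {n : ℕ} (P : Process en σ n) where
  open Process P
  open Bookkeeping P using (K; ToppleAt)

  siteAt : ℕ → Site (suc d)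
  siteAt i = proj₁ (Bijection.surjective en i)

  index-siteAt : ∀ i → index en (siteAt i) ≡ i
  index-siteAt i = proj₂ (Bijection.surjective en i) refl

  siteAt-index : ∀ y → siteAt (index en y) ≡ y
  siteAt-index y = Bijection.injective en (index-siteAt (index en y))

  siteAt-injective : ∀ {i j} → siteAt i ≡ siteAt j → i ≡ j
  siteAt-injective {i} {j} eq = trans (sym (index-siteAt i)) (trans (cong (index en) eq) (index-siteAt j))

  open InjectiveSum _≟ˢ_ siteAt siteAt-injective

  conf-suc-nonNeg-or-≥ : ∀ s y → + 0 ℤ.≤ conf (suc s) y ⊎ conf s y ℤ.≤ conf (suc s) y
  conf-suc-nonNeg-or-≥ s y with step s
  ... | inj₂ (_ , unchanged) = inj₂ (ℤP.≤-reflexive (sym (unchanged y)))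
  ... | inj₁ (z , z-unstable , _ , toppling) =
    Sum.map (λ 0≤ → ℤP.≤-trans 0≤ gain) (λ ≤ → ℤP.≤-trans ≤ gain) lost-cases
    where
    gain : conf s y - (if does (y ≟ˢ z) then + K else + 0) ℤ.≤ conf (suc s) y
    gain = subst (λ c → conf s y - (if does (y ≟ˢ z) then + K else + 0) ℤ.≤ c) (sym (toppling y))
                 (topple-≥ z (conf s) y)
    lost-cases : + 0 ℤ.≤ conf s y - (if does (y ≟ˢ z) then + K else + 0)
               ⊎ conf s y ℤ.≤ conf s y - (if does (y ≟ˢ z) then + K else + 0)
    lost-cases with y ≟ˢ z
    ... | yes refl = inj₁ (ℤP.i≤j⇒0≤j-i z-unstable)
    ... | no _     = inj₂ (ℤP.≤-reflexive (sym (ℤP.+-identityʳ (conf s y))))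

  module Potential (t : ℕ) (x : Site (suc d)) (x-unstable : Unstable (conf t) x) where

    k : ℕ
    k = index en x

    M : ℕ
    M = partialSum (λ i → ∣ V.head (siteAt i) ∣) k

    w : Site (suc d) → ℤ
    w = parabola (+ (suc M ℕ.* suc M))

    w-nonNeg : ∀ i → i ℕ.< k → + 0 ℤ.≤ w (siteAt i)
    w-nonNeg i i<k = parabola-nonNeg (siteAt i) (suc M) (ℕP.m≤n⇒m≤1+n (≤partialSum _ i<k)) ℤP.≤-refl

    w-nonNeg-neighbours : ∀ i → i ℕ.< k → ∀ u → u ∈ neighbours (siteAt i) → + 0 ℤ.≤ w u
    w-nonNeg-neighbours i i<k u u∈ = parabola-nonNeg u (suc M)
      (ℕP.≤-trans (∈neighbours⇒∣head∣≤ (siteAt i) u u∈) (s≤s (≤partialSum _ i<k))) ℤP.≤-refl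

    Φ : ℕ → ℤ
    Φ s = sumBelow k (λ i → w (siteAt i) * conf s (siteAt i))

    Φ-floor : ℤ
    Φ-floor = sumBelow k (λ i → w (siteAt i) * - + ∣ conf t (siteAt i) ∣)

    conf-lower : ∀ m y → - + ∣ conf t y ∣ ℤ.≤ conf (t ℕ.+ m) y
    conf-lower zero    y rewrite ℕP.+-identityʳ t = -∣i∣≤i (conf t y)
    conf-lower (suc m) y rewrite ℕP.+-suc t m with conf-suc-nonNeg-or-≥ (t ℕ.+ m) y
    ... | inj₁ 0≤ = ℤP.≤-trans ℤP.neg-≤-pos 0≤
    ... | inj₂ ≥  = ℤP.≤-trans (conf-lower m y) ≥

    Φ-floor≤Φ : ∀ m → Φ-floor ℤ.≤ Φ (t ℕ.+ m)
    Φ-floor≤Φ m = sumBelow-mono k (λ i i<k →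
      ℤP.*-monoˡ-≤-nonNeg (w (siteAt i)) {{ℤ.nonNegative (w-nonNeg i i<k)}} (conf-lower m (siteAt i)))

    module _ {s z} (z-topples : ToppleAt s z) (z≢x : z ≢ x) (x-unstable-at-s : Unstable (conf s) x) where

      lost : Site (suc d) → ℤ
      lost y = if does (y ≟ˢ z) then + K else + 0

      gained : Site (suc d) → ℤ
      gained y = if does (dist₁ z y ℕ.≟ 1) then + 1 else + 0

      toppling : ∀ y → conf (suc s) y ≡ (conf s y - lost y) + gained y
      toppling = proj₂ (proj₂ z-topples)

      index-z<k : index en z ℕ.< k
      index-z<k with ℕP.<-cmp (index en z) k
      ... | tri< z<x _ _ = z<x
      ... | tri≈ _ z≡x _ = ⊥-elim (z≢x (Bijection.injective en z≡x))
      ... | tri> _ _ z>x = ⊥-elim (Stable⇒¬Unstable (conf s) x (proj₁ (proj₂ z-topples) x z>x) x-unstable-at-s)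

      w-nonNeg-neighbours-z : ∀ u → u ∈ neighbours z → + 0 ℤ.≤ w u
      w-nonNeg-neighbours-z u u∈ = w-nonNeg-neighbours (index en z) index-z<k u
        (subst (λ v → u ∈ neighbours v) (sym (siteAt-index z)) u∈)

      total-lost : sumBelow k (λ i → w (siteAt i) * lost (siteAt i)) ≡ w z * + K
      total-lost = trans (sumBelow-single k (index en z) index-z<k others)
        (trans (cong (λ v → w v * lost v) (siteAt-index z)) (cong (w z *_) (if-does-yes (z ≟ˢ z) (+ K) refl)))
        where
        others : ∀ i → i ℕ.< k → i ≢ index en z → w (siteAt i) * lost (siteAt i) ≡ + 0
        others i _ i≢z = trans (cong (w (siteAt i) *_) (if-does-no (siteAt i ≟ˢ z) (+ K)
          (λ eq → i≢z (trans (sym (index-siteAt i)) (cong (index en) eq))))) (ℤP.*-zeroʳ (w (siteAt i)))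

      total-gained : sumBelow k (λ i → w (siteAt i) * gained (siteAt i)) ℤ.≤ + K * w z - + 2
      total-gained = ℤP.≤-trans (sumBelow≤sumOver k (neighbours z) w _ w-nonNeg-neighbours-z term≤)
        (ℤP.≤-reflexive (sumOver-neighbours-parabola (+ (suc M ℕ.* suc M)) z))
        where
        term≤ : ∀ i → i ℕ.< k → w (siteAt i) * gained (siteAt i) ℤ.≤
                sumOver (neighbours z) (λ u → + 𝟙 (siteAt i ≟ˢ u) * w u)
        term≤ i _ with if-does-cases (dist₁ z (siteAt i) ℕ.≟ 1) (+ 1)
        ... | inj₁ (z~i , g≡1) = ℤP.≤-trans
          (ℤP.≤-reflexive (trans (cong (w (siteAt i) *_) g≡1) (ℤP.*-identityʳ (w (siteAt i)))))
          (≤sumOver-𝟙* (neighbours z) (siteAt i) w (dist₁≡1⇒∈neighbours z (siteAt i) z~i) w-nonNeg-neighbours-z)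
        ... | inj₂ g≡0 = ℤP.≤-trans
          (ℤP.≤-reflexive (trans (cong (w (siteAt i) *_) g≡0) (ℤP.*-zeroʳ (w (siteAt i)))))
          (sumOver-nonNeg (neighbours z) (λ u u∈ → 𝟙*-nonNeg (siteAt i) u (w-nonNeg-neighbours-z u u∈)))

      Φ-decreases : Φ (suc s) + + 2 ℤ.≤ Φ s
      Φ-decreases = begin
        Φ (suc s) + + 2
          ≡⟨ cong (_+ + 2) (sumBelow-cong k (λ i _ → trans (cong (w (siteAt i) *_) (toppling (siteAt i)))
               (expand (w (siteAt i)) (conf s (siteAt i)) (lost (siteAt i)) (gained (siteAt i))))) ⟩
        sumBelow k (λ i → w (siteAt i) * conf s (siteAt i) + w (siteAt i) * gained (siteAt i)
                          + - (w (siteAt i) * lost (siteAt i))) + + 2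
          ≡⟨ cong (_+ + 2) (trans (sumBelow-+ k _ _)
               (cong₂ _+_ (sumBelow-+ k _ _) (trans (sumBelow-neg k _) (cong -_ total-lost)))) ⟩
        Φ s + sumBelow k (λ i → w (siteAt i) * gained (siteAt i)) + - (w z * + K) + + 2
          ≤⟨ ℤP.+-monoˡ-≤ (+ 2) (ℤP.+-monoˡ-≤ (- (w z * + K)) (ℤP.+-monoʳ-≤ (Φ s) total-gained)) ⟩
        Φ s + (+ K * w z - + 2) + - (w z * + K) + + 2
          ≡⟨ cancel (Φ s) (+ K) (w z) ⟩
        Φ s ∎
        where
        open ℤP.≤-Reasoning
        expand : ∀ w c a b → w * ((c - a) + b) ≡ w * c + w * b + - (w * a)
        expand = solve-∀
        cancel : ∀ p K w → p + (K * w - + 2) + - (w * K) + + 2 ≡ p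
        cancel = solve-∀

      x-stays-unstable : Unstable (conf (suc s)) x
      x-stays-unstable = ℤP.≤-trans x-unstable-at-s (ℤP.≤-trans (ℤP.≤-reflexive x-keeps)
        (subst (λ c → conf s x - lost x ℤ.≤ c) (sym (toppling x)) (topple-≥ z (conf s) x)))
        where
        x-keeps : conf s x ≡ conf s x - lost x
        x-keeps = trans (sym (ℤP.+-identityʳ (conf s x)))
                        (cong (λ v → conf s x - v) (sym (if-does-no (x ≟ˢ z) (+ K) (z≢x ∘ sym))))

    untoppled-descent : ∀ m → (∃ λ s → t ℕ.≤ s × ToppleAt s x)
                            ⊎ (Unstable (conf (t ℕ.+ m)) x × Φ (t ℕ.+ m) + + (2 ℕ.* m) ℤ.≤ Φ t)
    untoppled-descent zero rewrite ℕP.+-identityʳ t = inj₂ (x-unstable , ℤP.≤-reflexive (ℤP.+-identityʳ (Φ t)))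
    untoppled-descent (suc m) with untoppled-descent m
    ... | inj₁ found = inj₁ found
    ... | inj₂ (unstable , descent) rewrite ℕP.+-suc t m with step (t ℕ.+ m)
    ...   | inj₂ (all-stable , _) = ⊥-elim (Stable⇒¬Unstable (conf (t ℕ.+ m)) x (all-stable x) unstable)
    ...   | inj₁ (z , z-topples) with z ≟ˢ x
    ...     | yes refl = inj₁ (t ℕ.+ m , ℕP.m≤m+n t m , z-topples)
    ...     | no z≢x   = inj₂ (x-stays-unstable z-topples z≢x unstable , Φ-descent)
      where
      open ℤP.≤-Reasoning
      Φ-descent : Φ (suc (t ℕ.+ m)) + + (2 ℕ.* suc m) ℤ.≤ Φ t
      Φ-descent = begin
        Φ (suc (t ℕ.+ m)) + + (2 ℕ.* suc m)
          ≡⟨ cong (λ i → Φ (suc (t ℕ.+ m)) + i) (trans (cong +_ (ℕP.*-suc 2 m)) (ℤP.pos-+ 2 (2 ℕ.* m))) ⟩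
        Φ (suc (t ℕ.+ m)) + (+ 2 + + (2 ℕ.* m))
          ≡⟨ sym (ℤP.+-assoc (Φ (suc (t ℕ.+ m))) (+ 2) (+ (2 ℕ.* m))) ⟩
        Φ (suc (t ℕ.+ m)) + + 2 + + (2 ℕ.* m)
          ≤⟨ ℤP.+-monoˡ-≤ (+ (2 ℕ.* m)) (Φ-decreases z-topples z≢x unstable) ⟩
        Φ (t ℕ.+ m) + + (2 ℕ.* m)
          ≤⟨ descent ⟩
        Φ t ∎

    gap : ℕ
    gap = ∣ Φ t - Φ-floor ∣

    x-topples-eventually : ∃ λ s → t ℕ.≤ s × ToppleAt s x
    x-topples-eventually with untoppled-descent (suc gap)
    ... | inj₁ found = found
    ... | inj₂ (_ , descent) = ⊥-elim (ℕP.<⇒≱ gap<2[1+gap] (ℤP.drop‿+≤+ 2[1+gap]≤gap))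
      where
      gap<2[1+gap] : gap ℕ.< 2 ℕ.* suc gap
      gap<2[1+gap] = ℕP.≤-trans (ℕP.n<1+n gap) (ℕP.m≤m+n (suc gap) _)
      2[1+gap]≤gap : + (2 ℕ.* suc gap) ℤ.≤ + gap
      2[1+gap]≤gap = begin
        + (2 ℕ.* suc gap)                      ≡⟨ sym (i+j-i≡j Φ-floor _) ⟩
        Φ-floor + + (2 ℕ.* suc gap) - Φ-floor  ≤⟨ ℤP.+-monoˡ-≤ (- Φ-floor) (ℤP.≤-trans
                                                   (ℤP.+-monoˡ-≤ _ (Φ-floor≤Φ (suc gap))) descent) ⟩
        Φ t - Φ-floor                          ≤⟨ i≤∣i∣ (Φ t - Φ-floor) ⟩
        + gap                                  ∎
        where open ℤP.≤-Reasoning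

  eventually-topples : ∀ t x → Unstable (conf t) x → ∃ λ s → t ℕ.≤ s × ToppleAt s x
  eventually-topples = Potential.x-topples-eventually

-- Spreading of topplings

module Spreading {en : Enumeration (suc d)} {σ : Config (suc d)} {n : ℕ} (P : Process en σ n)
                 (σ≥K-2 : ∀ x → + (2 ℕ.* suc d) - + 2 ℤ.≤ σ x) where
  open Process P
  open Bookkeeping P
  open Fairness P using (eventually-topples)

  ToppledAtLeast : Site (suc d) → ℕ → Set
  ToppledAtLeast y T = ∃ λ t → T ℕ.≤ toppled t y

  Fires : Site (suc d) → Set
  Fires y = ToppledAtLeast y 1

  Charged : Site (suc d) → Set
  Charged y = + K - + 1 ℤ.≤ σ y

  σ≤conf₀ : ∀ y → σ y ℤ.≤ conf 0 y
  σ≤conf₀ y rewrite start y with y ≟ˢ origin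
  ... | yes _ = ℤP.i≤i+j (σ y) (+ n)
  ... | no _  = ℤP.≤-reflexive (sym (ℤP.+-identityʳ (σ y)))

  conf₀-origin : conf 0 origin ≡ σ origin + + n
  conf₀-origin = trans (start origin) (cong (λ i → σ origin + i) (if-does-yes (origin {suc d} ≟ˢ origin) (+ n) refl))

  σ-nonNeg : ∀ y → + 0 ℤ.≤ σ y
  σ-nonNeg y = ℤP.≤-trans (ℤP.i≤j⇒0≤j-i (ℤ.+≤+ (ℕP.*-monoʳ-≤ 2 (s≤s (z≤n {d}))))) (σ≥K-2 y)

  topples-enough : ∀ T y t → + (K ℕ.* suc T) ℤ.≤ conf 0 y + + received t y → ToppledAtLeast y (suc T)
  topples-enough T y t₀ enough₀ = go (suc T) t₀ (ℕP.m≤m+n (suc T) _) enough₀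
    where
    go : ∀ deficit t → suc T ℕ.≤ deficit ℕ.+ toppled t y → + (K ℕ.* suc T) ℤ.≤ conf 0 y + + received t y →
         ToppledAtLeast y (suc T)
    go deficit t within enough with suc T ℕP.≤? toppled t y
    ... | yes done = t , done
    go zero          t within enough | no not-done = ⊥-elim (not-done within)
    go (suc deficit) t within enough | no not-done
      with eventually-topples t y (unstable-while-undertoppled T t y (ℕP.≤-pred (ℕP.≰⇒> not-done)) enough)
    ... | s , t≤s , y-topples = go deficit (suc s)
      (ℕP.≤-trans within (ℕP.≤-trans (ℕP.≤-reflexive (sym (ℕP.+-suc deficit (toppled t y))))
                                     (ℕP.+-monoʳ-≤ deficit one-more)))
      (ℤP.≤-trans enough (ℤP.+-monoʳ-≤ (conf 0 y) (ℤ.+≤+ (partialSum-mono _ (ℕP.m≤n⇒m≤1+n t≤s)))))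
      where
      one-more : suc (toppled t y) ℕ.≤ toppled (suc s) y
      one-more = ℕP.≤-trans (s≤s (partialSum-mono _ t≤s))
        (ℕP.≤-reflexive (trans (ℕP.+-comm 1 _) (cong (toppled s y ℕ.+_) (sym (ToppleAt⇒toppledAt≡1 y-topples)))))

  topples-if-received : ∀ T y t → K ℕ.* suc T ℕ.≤ received t y → ToppledAtLeast y (suc T)
  topples-if-received T y t K[1+T]≤ = topples-enough T y t
    (ℤP.≤-trans (ℤP.≤-reflexive (sym (ℤP.+-identityˡ _)))
                (ℤP.+-mono-≤ (ℤP.≤-trans (σ-nonNeg y) (σ≤conf₀ y)) (ℤ.+≤+ K[1+T]≤)))

  fires-from-two-neighbours : ∀ {z₁ z₂ y} → z₁ ≢ z₂ → dist₁ z₁ y ≡ 1 → dist₁ z₂ y ≡ 1 →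
                              Fires z₁ → Fires z₂ → Fires y
  fires-from-two-neighbours {z₁} {z₂} {y} z₁≢z₂ z₁~y z₂~y (t₁ , fired₁) (t₂ , fired₂) =
    topples-enough 0 y (t₁ ℕ.+ t₂) (ℤP.≤-trans (ℤP.≤-reflexive K≡K-2+2)
      (ℤP.+-mono-≤ (ℤP.≤-trans (σ≥K-2 y) (σ≤conf₀ y)) (ℤ.+≤+ two-received)))
    where
    K≡K-2+2 : + (K ℕ.* 1) ≡ + K - + 2 + + 2
    K≡K-2+2 = trans (cong +_ (ℕP.*-identityʳ K)) (i≡i-j+j (+ K) (+ 2))
    two-received : 2 ℕ.≤ received (t₁ ℕ.+ t₂) y
    two-received = ℕP.≤-trans
      (ℕP.+-mono-≤ (ℕP.≤-trans fired₁ (partialSum-mono _ (ℕP.m≤m+n t₁ t₂)))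
                   (ℕP.≤-trans fired₂ (partialSum-mono _ (ℕP.m≤n+m t₂ t₁))))
      (received≥toppled₂ z₁≢z₂ z₁~y z₂~y (t₁ ℕ.+ t₂))

  fires-from-one-neighbour : ∀ {z y} → dist₁ z y ≡ 1 → Charged y → Fires z → Fires y
  fires-from-one-neighbour {z} {y} z~y charged (t , fired) =
    topples-enough 0 y t (ℤP.≤-trans (ℤP.≤-reflexive K≡K-1+1)
      (ℤP.+-mono-≤ (ℤP.≤-trans charged (σ≤conf₀ y)) (ℤ.+≤+ (ℕP.≤-trans fired (received≥toppled z~y t)))))
    where
    K≡K-1+1 : + (K ℕ.* 1) ≡ + K - + 1 + + 1
    K≡K-1+1 = trans (cong +_ (ℕP.*-identityʳ K)) (i≡i-j+j (+ K) (+ 1))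

  origin-topples : ∀ T → K ℕ.* suc T ℕ.≤ n → ToppledAtLeast origin (suc T)
  origin-topples T K[1+T]≤n = topples-enough T origin 0 (begin
    + (K ℕ.* suc T)        ≤⟨ ℤ.+≤+ K[1+T]≤n ⟩
    + n                    ≤⟨ ℤP.≤-trans (ℤP.≤-reflexive (sym (ℤP.+-identityˡ (+ n))))
                                         (ℤP.+-monoˡ-≤ (+ n) (σ-nonNeg origin)) ⟩
    σ origin + + n         ≡⟨ sym (trans (ℤP.+-identityʳ (conf 0 origin)) conf₀-origin) ⟩
    conf 0 origin + + 0    ∎)
    where open ℤP.≤-Reasoning

  topples-at-distance : ∀ r T y → dist₁ y origin ≡ r → K ℕ.* T ℕ.* K ℕ.^ r ℕ.≤ n → ToppledAtLeast y T
  topples-at-distance r       zero    y _ _ = 0 , z≤n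
  topples-at-distance zero    (suc T) y y~o bound rewrite dist₁≡0⇒≡ y origin y~o =
    origin-topples T (ℕP.≤-trans (ℕP.≤-reflexive (sym (ℕP.*-identityʳ _))) bound)
  topples-at-distance (suc r) (suc T) y y~o bound =
    topples-if-received T y (proj₁ z-topples)
      (ℕP.≤-trans (proj₂ z-topples) (received≥toppled z~y (proj₁ z-topples)))
    where
    y≢origin : y ≢ origin
    y≢origin refl = ℕP.0≢1+n (trans (sym (dist₁-refl (origin {suc d}))) y~o)
    k : Fin (suc d)
    k = proj₁ (≢⇒∃lookup≢ y origin y≢origin)
    z : Site (suc d)
    z = stepToward k y origin
    z~y : dist₁ z y ≡ 1
    z~y = dist₁-stepToward-from k y origin
    z~o : dist₁ z origin ≡ r
    z~o = ℕP.suc-injective (trans (dist₁-stepToward k y origin (proj₂ (≢⇒∃lookup≢ y origin y≢origin))) y~o)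
    rearrange : ∀ K a b → K ℕ.* (K ℕ.* a) ℕ.* b ≡ K ℕ.* a ℕ.* (K ℕ.* b)
    rearrange = ℕ-Solver.solve-∀
    z-topples : ToppledAtLeast z (K ℕ.* suc T)
    z-topples = topples-at-distance r (K ℕ.* suc T) z z~o
      (ℕP.≤-trans (ℕP.≤-reflexive (rearrange K (suc T) (K ℕ.^ r))) bound)

  topples-near-origin : ∀ r T y → dist₁ y origin ℕ.≤ r → K ℕ.* T ℕ.* K ℕ.^ r ℕ.≤ n → ToppledAtLeast y T
  topples-near-origin r T y y≤r bound = topples-at-distance _ T y refl
    (ℕP.≤-trans (ℕP.*-monoʳ-≤ (K ℕ.* T) (ℕP.^-monoʳ-≤ K y≤r)) bound)

  AllFire : (Fin (suc d) → ℕ) → Set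
  AllFire b = ∀ y → InBox b y → Fires y

  -- Induction on the distance to the seed s: every other slab site has two firing neighbours, the
  -- one beside it in the adjacent slab and one a step closer to s.
  slab-fires : ∀ {b} m c δ → ∣ δ ∣ ≡ 1 →
    (∀ y → InBox b y → lookup y m ≡ c → Fires (shift m δ y)) →
    ∀ s → InBox b s → lookup s m ≡ c → Fires s →
    ∀ y → InBox b y → lookup y m ≡ c → Fires y
  slab-fires {b} m c δ ∣δ∣≡1 beside-fires s s∈B sₘ≡c s-fires y = go (dist₁ y s) y refl
    where
    go : ∀ f y → dist₁ y s ≡ f → InBox b y → lookup y m ≡ c → Fires y
    go zero    y y~s _   _    rewrite dist₁≡0⇒≡ y s y~s = s-fires
    go (suc f) y y~s y∈B yₘ≡c =
      fires-from-two-neighbours y'≢beside y'~y beside~y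
        (go f y' y'~s y'∈B y'ₘ≡c) (beside-fires y y∈B yₘ≡c)
      where
      y≢s : y ≢ s
      y≢s refl = ℕP.0≢1+n (trans (sym (dist₁-refl y)) y~s)
      k : Fin (suc d)
      k = proj₁ (≢⇒∃lookup≢ y s y≢s)
      yₖ≢sₖ : lookup y k ≢ lookup s k
      yₖ≢sₖ = proj₂ (≢⇒∃lookup≢ y s y≢s)
      m≢k : m ≢ k
      m≢k m≡k = yₖ≢sₖ (subst (λ i → lookup y i ≡ lookup s i) m≡k (trans yₘ≡c (sym sₘ≡c)))
      y' : Site (suc d)
      y' = stepToward k y s
      y'~s : dist₁ y' s ≡ f
      y'~s = ℕP.suc-injective (trans (dist₁-stepToward k y s yₖ≢sₖ) y~s)
      y'∈B : InBox b y'
      y'∈B = InBox-shift {y = y} k (unitToward (lookup y k) (lookup s k)) y∈B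
                         (unitToward-stays yₖ≢sₖ (y∈B k) (s∈B k))
      y'ₘ≡c : lookup y' m ≡ c
      y'ₘ≡c = trans (VP.lookup∘updateAt′ m k m≢k y) yₘ≡c
      y'~y : dist₁ y' y ≡ 1
      y'~y = dist₁-stepToward-from k y s
      beside~y : dist₁ (shift m δ y) y ≡ 1
      beside~y = trans (dist₁-shift m δ y) ∣δ∣≡1
      y'≢beside : y' ≢ shift m δ y
      y'≢beside y'≡ = ∣δ∣≡1⇒i≢i+δ ∣δ∣≡1 (trans (sym y'ₘ≡c) (trans (cong (λ v → lookup v m) y'≡)
        (trans (VP.lookup∘updateAt m y) (cong (_+ δ) yₘ≡c))))

  FacesCharged : ℕ → Set
  FacesCharged r = ∀ (i : Fin (suc d ℕ.+ suc d)) → ∃ λ x → InFace i r x × Charged x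

  face-seed : ∀ {r} → FacesCharged r → ∀ m c → ∣ c ∣ ≡ suc r →
    ∃ λ x → Charged x × (∀ k → k ≢ m → ∣ lookup x k ∣ ℕ.≤ r) × lookup x m ≡ c
  face-seed faces m c ∣c∣≡1+r with ∣i∣≡1+n⇒ {c} ∣c∣≡1+r
  ... | inj₁ refl with faces (m Fin.↑ˡ suc d)
  ...   | x , x∈F , charged = x , charged , face-↑ˡ x∈F
  face-seed faces m c ∣c∣≡1+r | inj₂ refl with faces (suc d Fin.↑ʳ m)
  ...   | x , x∈F , charged = x , charged , face-↑ʳ x∈F

  grow-box : ∀ {r j} m → Fin.toℕ m ≡ j → FacesCharged r →
             AllFire (growingBox r j) → AllFire (growingBox r (suc j))
  grow-box {r} {j} m m≡j faces old-fires y y∈new with ∣ lookup y m ∣ ℕP.≤? r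
  ... | yes ∣yₘ∣≤r = old-fires y (InBox-by-axis {y = y} m
        (subst (∣ lookup y m ∣ ℕ.≤_) (sym (growingBox-at r m m≡j)) ∣yₘ∣≤r)
        (λ k k≢m → subst (∣ lookup y k ∣ ℕ.≤_) (growingBox-suc-off r m≡j k≢m) (y∈new k)))
  ... | no ∣yₘ∣≰r = outer-slab-fires
        (ℕP.≤-antisym (subst (∣ lookup y m ∣ ℕ.≤_) (growingBox-suc-at r m m≡j) (y∈new m)) (ℕP.≰⇒> ∣yₘ∣≰r))
        y y∈new refl
    where
    outer-slab-fires : ∀ {c} → ∣ c ∣ ≡ suc r →
                       ∀ y → InBox (growingBox r (suc j)) y → lookup y m ≡ c → Fires y
    outer-slab-fires {c} ∣c∣≡1+r with face-seed faces m c ∣c∣≡1+r | ∣i∣≡1+n⇒∃inward {c} ∣c∣≡1+r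
    ... | x , charged , x-off-axis , xₘ≡c | δ , ∣δ∣≡1 , ∣c+δ∣≡r =
      slab-fires m c δ ∣δ∣≡1 inward-fires x x∈new xₘ≡c x-fires
      where
      inward-fires : ∀ y → InBox (growingBox r (suc j)) y → lookup y m ≡ c → Fires (shift m δ y)
      inward-fires y y∈new yₘ≡c = old-fires (shift m δ y) (InBox-by-axis {y = shift m δ y} m
        (ℕP.≤-reflexive (trans (cong ∣_∣ (trans (VP.lookup∘updateAt m {_+ δ} y) (cong (_+ δ) yₘ≡c)))
                               (trans ∣c+δ∣≡r (sym (growingBox-at r m m≡j)))))
        (λ k k≢m → subst₂ ℕ._≤_ (cong ∣_∣ (sym (VP.lookup∘updateAt′ k m {_+ δ} k≢m y)))
                                 (growingBox-suc-off r m≡j k≢m) (y∈new k)))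
      x∈new : InBox (growingBox r (suc j)) x
      x∈new = InBox-by-axis {y = x} m
        (ℕP.≤-reflexive (trans (cong ∣_∣ xₘ≡c) (trans ∣c∣≡1+r (sym (growingBox-suc-at r m m≡j)))))
        (λ k k≢m → ℕP.≤-trans (x-off-axis k k≢m) (r≤growingBox r (suc j) k))
      x-fires : Fires x
      x-fires = fires-from-one-neighbour (trans (dist₁-shift m δ x) ∣δ∣≡1) charged
                                         (inward-fires x x∈new xₘ≡c)

  cube-step : ∀ {r} → FacesCharged r → AllFire (λ _ → r) → AllFire (λ _ → suc r)
  cube-step {r} faces cube-fires y y∈ =
    grown (suc d) ℕP.≤-refl y (λ k → subst (∣ lookup y k ∣ ℕ.≤_) (sym (growingBox-full r k)) (y∈ k))
    where
    grown : ∀ j → j ℕ.≤ suc d → AllFire (growingBox r j)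
    grown zero    _   y y∈ = cube-fires y (λ k → subst (∣ lookup y k ∣ ℕ.≤_) (growingBox-zero r k) (y∈ k))
    grown (suc j) j<d = grow-box (Fin.fromℕ< j<d) (FinP.toℕ-fromℕ< j<d) faces
                                 (grown j (ℕP.≤-trans (ℕP.n≤1+n j) j<d))

  all-fire : ∀ r₀ → (∀ r → r₀ ℕ.≤ r → FacesCharged r) → K ℕ.* 1 ℕ.* K ℕ.^ (suc d ℕ.* r₀) ℕ.≤ n →
             ∀ y → Fires y
  all-fire r₀ faces bound y = cube-fires (dist₁ y origin) y
    (λ k → ℕP.≤-trans (∣lookup∣≤dist₁-origin y k) (ℕP.m≤n+m _ r₀))
    where
    cube-fires : ∀ i → AllFire (λ _ → r₀ ℕ.+ i)
    cube-fires zero y y∈ rewrite ℕP.+-identityʳ r₀ =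
      topples-near-origin (suc d ℕ.* r₀) 1 y (InBox-const⇒dist₁-origin≤ y y∈) bound
    cube-fires (suc i) rewrite ℕP.+-suc r₀ i = cube-step (faces (r₀ ℕ.+ i) (ℕP.m≤m+n r₀ i)) (cube-fires i)

no-enumeration-of-ℤ⁰ : ¬ Enumeration 0
no-enumeration-of-ℤ⁰ en with Bijection.surjective en 0 | Bijection.surjective en 1
... | [] , from0 | [] , from1 with trans (sym (from0 refl)) (from1 refl)
... | ()

theorem4p1 : (d : ℕ) (σ : Config d) →
    (∀ x → + (2 ℕ.* d) - + 2 ℤ.≤ σ x) →
    (∃ λ r₀ → ∀ r → r₀ ℕ.≤ r → ∀ (i : Fin (d ℕ.+ d)) →
      ∃ λ x → InFace i r x × + (2 ℕ.* d) - + 1 ℤ.≤ σ x) →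
    (en : Enumeration d) → Explosive en σ
theorem4p1 zero    σ _      _            en = ⊥-elim (no-enumeration-of-ℤ⁰ en)
theorem4p1 (suc d) σ σ≥K-2 (r₀ , faces) en = n , n≥1 , topples
  where
  K = 2 ℕ.* suc d
  n = K ℕ.* 1 ℕ.* K ℕ.^ (suc d ℕ.* r₀)
  n≥1 : 1 ℕ.≤ n
  n≥1 = ℕP.*-mono-≤ (ℕP.≤-trans (s≤s z≤n) (ℕP.≤-reflexive (sym (ℕP.*-identityʳ K))))
                    (ℕP.m^n>0 K (suc d ℕ.* r₀))
  topples : (P : Process en σ n) → ∀ x → Topples P x
  topples P x with Spreading.all-fire P σ≥K-2 r₀ faces ℕP.≤-refl x
  ... | t , fired = Bookkeeping.toppled-pos⇒ToppleAt P t x fired
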